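{- Let $l,m,k_1,\ldots,k_l$ be positive integers with $k_1+\cdots+k_l-2\ge m(l-2)$. For each $h=1,\ldots,l$ let $\pi_h$ be a partition of the number $m$ into $k_h$ nonzero parts. Then there exist partitions $\Pi_1,\ldots,\Pi_l$ of the set $[m]=\{1,\ldots,m\}$ such that for each $h$ the multiset of sizes of the parts of $\Pi_h$ is $\pi_h$, and such that the coarsest common refinement of any three of the $\Pi_h$ is the partition of $[m]$ into singletons. -}

module Defs where

open import Data.Nat using (ℕ; _≤_)
open import Data.Fin using (Fin; _≟_)
open import Data.Vec using (Vec; sum; toList; tabulate)
open import Data.Vec.Relation.Unary.All using (All)
open import Data.List using (length; filter; allFin)
open import Data.List.Relation.Binary.Permutation.Propositional using (_↭_)
open import Data.Product using (_×_)
open import Relation.Binary.PropositionalEquality using (_≡_; _≢_)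

-- A partition of the number m into k nonzero parts: a vector of k positive
-- naturals summing to m (regarded as a multiset; order irrelevant).
IsNumPartition : (m k : ℕ) → Vec ℕ k → Set
IsNumPartition m k π = All (1 ≤_) π × sum π ≡ m

-- A set partition of [m] = Fin m into k blocks is represented by a labelling
-- f : Fin m → Fin k; block j is f⁻¹(j).  Its block sizes:
blockSize : {m k : ℕ} → (Fin m → Fin k) → Fin k → ℕ
blockSize {m} f j = length (filter (λ x → f x ≟ j) (allFin m))

blockSizes : {m k : ℕ} → (Fin m → Fin k) → Vec ℕ k
blockSizes f = tabulate (blockSize f)

-- The multiset of block sizes of the partition given by f equals π
-- (blocks are then automatically nonempty when π has positive parts,
-- so f describes a genuine set partition with exactly k blocks).
HasShape : {m k : ℕ} → (Fin m → Fin k) → Vec ℕ k → Set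
HasShape f π = toList (blockSizes f) ↭ toList π

-- The coarsest common refinement of the partitions given by f, g, h is the
-- partition into singletons: two elements lying in a common block of each
-- of f, g, h are equal.
MeetIsDiscrete : {m a b c : ℕ} → (Fin m → Fin a) → (Fin m → Fin b) → (Fin m → Fin c) → Set
MeetIsDiscrete {m} f g h = (x y : Fin m) → f x ≡ f y → g x ≡ g y → h x ≡ h y → x ≡ y

module Submission where

-- A number partition of m into
-- k parts is a vector Fin k → ℕ whose deficiency Σⱼ (πⱼ - 1) equals m - k, so
-- the hypothesis Σₕ kₕ - 2 ≥ m(l - 2) says that the total deficiency D of the
-- family is at most 2(m - 1).  Every family with D ≤ 2(m - 1) is
-- realised, by strong induction on m: let h₁, h₂ be the two heaviest partitions
-- (weight = deficiency, plus m if there is no singleton block).  If all others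
-- have a singleton block we remove one point, lying in singleton blocks outside
-- h₁, h₂; otherwise counting against D forces a configuration from which two
-- points can be removed at once.

open import Defs
open import Data.Empty using (⊥; ⊥-elim)
open import Data.Fin using (Fin; zero; suc; _≟_)
open import Data.Fin.Properties using (any?)
import Data.List as List
open import Data.List.Relation.Binary.Permutation.Propositional using (↭-reflexive)
open import Data.Nat using (ℕ; zero; suc; _+_; _*_; _∸_; _≤_; _<_; z≤n; s≤s; _≤?_)
import Data.Nat as ℕ
open import Data.Nat.Induction using (<-rec)
open import Data.Nat.Properties hiding (_≟_)
open import Data.Nat.Tactic.RingSolver using (solve-∀)
open import Algebra.Properties.CommutativeMonoid.Sum +-0-commutativeMonoid
  using (sum; ∑-distrib-+; sum-cong-≗; sum-replicate-zero)
open import Algebra.Properties.CommutativeSemigroup +-commutativeSemigroup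
  using (x∙yz≈y∙xz; xy∙z≈x∙zy)
open import Data.Product using (Σ; Σ-syntax; _×_; _,_; proj₁; proj₂)
open import Data.Sum using (_⊎_; inj₁; inj₂; [_,_]′)
open import Data.Vec as Vec using (Vec; lookup; toList)
open import Data.Vec.Properties using (tabulate-cong; tabulate∘lookup)
open import Data.Vec.Relation.Unary.All.Properties using (lookup⁺)
open import Data.Vec.Functional using (Vector; _∷_; updateAt)
open import Data.Vec.Functional.Properties using (updateAt-updates; updateAt-minimal)
open import Function using (_∘_)
open import Relation.Binary.PropositionalEquality
open import Relation.Nullary using (¬_; Dec; yes; no; ¬?)
open import Relation.Nullary.Decidable using (_×-dec_; decidable-stable)
open import Relation.Unary using (Decidable)

sum-mono : ∀ {n} {f g : Vector ℕ n} → (∀ i → f i ≤ g i) → sum f ≤ sum g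
sum-mono {zero}  f≤g = z≤n
sum-mono {suc n} f≤g = +-mono-≤ (f≤g zero) (sum-mono (f≤g ∘ suc))

sum-zeros : ∀ {n} {g : Vector ℕ n} → (∀ i → g i ≡ 0) → sum g ≡ 0
sum-zeros {n} g≡0 = trans (sum-cong-≗ g≡0) (sum-replicate-zero n)

sum-const : ∀ n c → sum {n} (λ _ → c) ≡ n * c
sum-const zero    c = refl
sum-const (suc n) c = cong (c +_) (sum-const n c)

sum-updateAt : ∀ {n} (g : Vector ℕ n) (u : Fin n) (φ : ℕ → ℕ) →
               sum (updateAt g u φ) + g u ≡ φ (g u) + sum g
sum-updateAt {suc n} g zero φ = begin
  φ (g zero) + sum (g ∘ suc) + g zero   ≡⟨ +-assoc (φ (g zero)) _ _ ⟩
  φ (g zero) + (sum (g ∘ suc) + g zero) ≡⟨ cong (φ (g zero) +_) (+-comm (sum (g ∘ suc)) _) ⟩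
  φ (g zero) + (g zero + sum (g ∘ suc)) ∎
  where open ≡-Reasoning
sum-updateAt {suc n} g (suc u) φ = begin
  g zero + sum (updateAt (g ∘ suc) u φ) + g (suc u)   ≡⟨ +-assoc (g zero) _ _ ⟩
  g zero + (sum (updateAt (g ∘ suc) u φ) + g (suc u)) ≡⟨ cong (g zero +_) (sum-updateAt (g ∘ suc) u φ) ⟩
  g zero + (φ (g (suc u)) + sum (g ∘ suc))            ≡⟨ x∙yz≈y∙xz (g zero) (φ (g (suc u))) (sum (g ∘ suc)) ⟩
  φ (g (suc u)) + (g zero + sum (g ∘ suc))            ∎
  where open ≡-Reasoning

without : ∀ {n} → Vector ℕ n → Fin n → Vector ℕ n
without g a = updateAt g a (λ _ → 0)

sum-split : ∀ {n} (g : Vector ℕ n) (a : Fin n) → sum g ≡ g a + sum (without g a)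
sum-split g a = trans (sym (sum-updateAt g a (λ _ → 0))) (+-comm (sum (without g a)) (g a))

without-other : ∀ {n} (g : Vector ℕ n) {a b} → a ≢ b → without g a b ≡ g b
without-other g {a} {b} a≢b = updateAt-minimal b a g (a≢b ∘ sym)

term≤sum : ∀ {n} (g : Vector ℕ n) a → g a ≤ sum g
term≤sum g a = begin
  g a                     ≤⟨ m≤m+n (g a) _ ⟩
  g a + sum (without g a) ≡⟨ sum-split g a ⟨
  sum g                   ∎
  where open ≤-Reasoning

pair≤sum : ∀ {n} (g : Vector ℕ n) {a b} → a ≢ b → g a + g b ≤ sum g
pair≤sum g {a} {b} a≢b = begin
  g a + g b               ≡⟨ cong (g a +_) (without-other g a≢b) ⟨
  g a + without g a b     ≤⟨ +-monoʳ-≤ (g a) (term≤sum (without g a) b) ⟩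
  g a + sum (without g a) ≡⟨ sum-split g a ⟨
  sum g                   ∎
  where open ≤-Reasoning

triple≤sum : ∀ {n} (g : Vector ℕ n) {a b c} → a ≢ b → a ≢ c → b ≢ c → g a + g b + g c ≤ sum g
triple≤sum g {a} {b} {c} a≢b a≢c b≢c = begin
  g a + g b + g c                       ≡⟨ +-assoc (g a) (g b) (g c) ⟩
  g a + (g b + g c)                     ≡⟨ cong (g a +_) (cong₂ _+_ (without-other g a≢b) (without-other g a≢c)) ⟨
  g a + (without g a b + without g a c) ≤⟨ +-monoʳ-≤ (g a) (pair≤sum (without g a) b≢c) ⟩
  g a + sum (without g a)               ≡⟨ sum-split g a ⟨
  sum g                                 ∎
  where open ≤-Reasoning

quad≤sum : ∀ {n} (g : Vector ℕ n) {a b c e} → a ≢ b → a ≢ c → a ≢ e → b ≢ c → b ≢ e → c ≢ e →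
           g a + g b + g c + g e ≤ sum g
quad≤sum g {a} {b} {c} {e} a≢b a≢c a≢e b≢c b≢e c≢e = begin
  g a + g b + g c + g e                               ≡⟨ regroup (g a) (g b) (g c) (g e) ⟩
  g a + (g b + g c + g e)                             ≡⟨ cong (g a +_) unchanged ⟨
  g a + (without g a b + without g a c + without g a e) ≤⟨ +-monoʳ-≤ (g a) (triple≤sum (without g a) b≢c b≢e c≢e) ⟩
  g a + sum (without g a)                             ≡⟨ sum-split g a ⟨
  sum g                                               ∎
  where
    open ≤-Reasoning
    regroup : ∀ w x y z → w + x + y + z ≡ w + (x + y + z)
    regroup = solve-∀
    unchanged : without g a b + without g a c + without g a e ≡ g b + g c + g e
    unchanged = cong₂ _+_ (cong₂ _+_ (without-other g a≢b) (without-other g a≢c)) (without-other g a≢e)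

sum-single : ∀ {n} (g : Vector ℕ n) a → (∀ j → j ≢ a → g j ≡ 0) → sum g ≡ g a
sum-single g a others≡0 = begin
  sum g                   ≡⟨ sum-split g a ⟩
  g a + sum (without g a) ≡⟨ cong (g a +_) (sum-zeros without≡0) ⟩
  g a + 0                 ≡⟨ +-identityʳ (g a) ⟩
  g a                     ∎
  where
    open ≡-Reasoning
    without≡0 : ∀ j → without g a j ≡ 0
    without≡0 j with j ≟ a
    ... | yes refl = updateAt-updates a g
    ... | no j≢a   = trans (updateAt-minimal j a g j≢a) (others≡0 j j≢a)

sum-gap : ∀ {n} {f g : Vector ℕ n} {a b} c → a ≢ b → (∀ i → f i ≤ g i) →
          c + f a ≤ g a → c + f b ≤ g b → c + c + sum f ≤ sum g
sum-gap {f = f} {g} {a} {b} c a≢b f≤g gap-a gap-b = begin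
  c + c + sum f          ≡⟨ +-comm (c + c) (sum f) ⟩
  sum f + (c + c)        ≤⟨ +-monoʳ-≤ (sum f) (≤-trans (+-mono-≤ (gap gap-a) (gap gap-b)) (pair≤sum surplus a≢b)) ⟩
  sum f + sum surplus    ≡⟨ ∑-distrib-+ f surplus ⟨
  sum (λ i → f i + surplus i) ≡⟨ sum-cong-≗ (λ i → m+[n∸m]≡n (f≤g i)) ⟩
  sum g                  ∎
  where
    open ≤-Reasoning
    surplus : Vector ℕ _
    surplus i = g i ∸ f i
    gap : ∀ {i} → c + f i ≤ g i → c ≤ surplus i
    gap {i} le = subst (_≤ surplus i) (m+n∸n≡m c (f i)) (∸-monoˡ-≤ (f i) le)

sum-≤-except-one : ∀ {n} (f g : Vector ℕ n) a → (∀ j → j ≢ a → f j ≤ g j) → f a ≤ g a + 1 →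
                   sum f ≤ sum g + 1
sum-≤-except-one f g a f≤g fa≤ga+1 = begin
  sum f                         ≡⟨ sum-split f a ⟩
  f a + sum (without f a)       ≤⟨ +-mono-≤ fa≤ga+1 (sum-mono without-≤) ⟩
  g a + 1 + sum (without g a)   ≡⟨ xy∙z≈x∙zy (g a) 1 (sum (without g a)) ⟩
  g a + (sum (without g a) + 1) ≡⟨ +-assoc (g a) _ 1 ⟨
  g a + sum (without g a) + 1   ≡⟨ cong (_+ 1) (sum-split g a) ⟨
  sum g + 1                     ∎
  where
    open ≤-Reasoning
    without-≤ : ∀ j → without f a j ≤ without g a j
    without-≤ j with j ≟ a
    ... | yes refl = ≤-reflexive (trans (updateAt-updates a f) (sym (updateAt-updates a g)))
    ... | no j≢a   = subst₂ _≤_ (sym (updateAt-minimal j a f j≢a)) (sym (updateAt-minimal j a g j≢a)) (f≤g j j≢a)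

positive-term : ∀ {n} (g : Vector ℕ n) → 1 ≤ sum g → Σ[ j ∈ Fin n ] 1 ≤ g j
positive-term {suc n} g pos with g zero in g₀≡
... | suc _ = zero , subst (1 ≤_) (sym g₀≡) (s≤s z≤n)
... | zero  with positive-term (g ∘ suc) pos
...   | j , 1≤gj = suc j , 1≤gj

excess : ∀ {k} → Vector ℕ k → Vector ℕ k
excess π j = π j ∸ 1

deficiency : ∀ {k} → Vector ℕ k → ℕ
deficiency π = sum (excess π)

deficiency+parts : ∀ {k} (π : Vector ℕ k) → (∀ j → 1 ≤ π j) → deficiency π + k ≡ sum π
deficiency+parts {k} π positive = begin
  deficiency π + k                      ≡⟨ cong (deficiency π +_) (trans (sum-const k 1) (*-identityʳ k)) ⟨
  deficiency π + sum {k} (λ _ → 1)      ≡⟨ ∑-distrib-+ (excess π) (λ _ → 1) ⟨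
  sum (λ j → π j ∸ 1 + 1)               ≡⟨ sum-cong-≗ (λ j → m∸n+n≡m (positive j)) ⟩
  sum π                                 ∎
  where open ≡-Reasoning

deficiency≤sum : ∀ {k} (π : Vector ℕ k) → deficiency π ≤ sum π
deficiency≤sum π = sum-mono (λ j → m∸n≤m (π j) 1)

deficiency<sum : ∀ {k} (π : Vector ℕ k) → 1 ≤ sum π → suc (deficiency π) ≤ sum π
deficiency<sum {suc k} π positive with π zero
... | zero  = deficiency<sum (π ∘ suc) positive
... | suc x = s≤s (+-monoʳ-≤ x (deficiency≤sum (π ∘ suc)))

decrement : ∀ {k} → Vector ℕ k → Fin k → Vector ℕ k
decrement π u = updateAt π u (_∸ 1)

sum-decrement : ∀ {k} (π : Vector ℕ k) u → 1 ≤ π u → suc (sum (decrement π u)) ≡ sum π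
sum-decrement π u nonempty with π u | sum-updateAt π u (_∸ 1)
... | suc x | shifted = +-cancelʳ-≡ x _ _ (begin
  suc (sum (decrement π u)) + x ≡⟨ +-suc (sum (decrement π u)) x ⟨
  sum (decrement π u) + suc x   ≡⟨ shifted ⟩
  x + sum π                     ≡⟨ +-comm x (sum π) ⟩
  sum π + x                     ∎)
  where open ≡-Reasoning

decrement-≤ : ∀ {k} (π : Vector ℕ k) u j → decrement π u j ≤ π j
decrement-≤ π u j with j ≟ u
... | yes refl = ≤-trans (≤-reflexive (updateAt-updates u π)) (m∸n≤m (π u) 1)
... | no j≢u   = ≤-reflexive (updateAt-minimal j u π j≢u)

deficiency-decrement : ∀ {k} (π : Vector ℕ k) u → 2 ≤ π u →
                       suc (deficiency (decrement π u)) ≡ deficiency π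
deficiency-decrement π u large = trans
  (cong suc (sum-cong-≗ excess-commutes))
  (sum-decrement (excess π) u (∸-monoˡ-≤ 1 large))
  where
    excess-commutes : ∀ j → excess (decrement π u) j ≡ decrement (excess π) u j
    excess-commutes j with j ≟ u
    ... | yes refl = trans (cong (_∸ 1) (updateAt-updates u π))
                           (sym (updateAt-updates u (excess π)))
    ... | no j≢u   = trans (cong (_∸ 1) (updateAt-minimal j u π j≢u))
                           (sym (updateAt-minimal j u (excess π) j≢u))

deficiency-decrement-≤ : ∀ {k} (π : Vector ℕ k) u → deficiency (decrement π u) ≤ deficiency π
deficiency-decrement-≤ π u = sum-mono (λ j → ∸-monoˡ-≤ 1 (decrement-≤ π u j))

part≤excess+1 : ∀ x → x ≤ (x ∸ 1) + 1
part≤excess+1 zero    = z≤n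
part≤excess+1 (suc x) = ≤-reflexive (+-comm 1 x)

part≤2excess+1 : ∀ x → x ≤ (x ∸ 1) + (x ∸ 1) + 1
part≤2excess+1 zero    = z≤n
part≤2excess+1 (suc x) = ≤-trans (part≤excess+1 (suc x)) (+-monoˡ-≤ 1 (m≤m+n x x))

part≤2excess : ∀ x → x ≢ 1 → x ≤ (x ∸ 1) + (x ∸ 1)
part≤2excess zero          _   = z≤n
part≤2excess (suc zero)    x≢1 = ⊥-elim (x≢1 refl)
part≤2excess (suc (suc x)) _   = s≤s (m≤n+m (suc x) x)

2part≤3excess : ∀ x → x ≢ 1 → x ≢ 2 → x + x ≤ (x ∸ 1) + (x ∸ 1) + (x ∸ 1)
2part≤3excess zero                _   _   = z≤n
2part≤3excess (suc zero)          x≢1 _   = ⊥-elim (x≢1 refl)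
2part≤3excess (suc (suc zero))    _   x≢2 = ⊥-elim (x≢2 refl)
2part≤3excess (suc (suc (suc y))) _   _   =
  subst₂ _≤_ (sym (twice y)) (sym (thrice y)) (+-monoʳ-≤ 6 (m≤m+n (y + y) y))
  where
    twice : ∀ y → suc (suc (suc y)) + suc (suc (suc y)) ≡ 6 + (y + y)
    twice = solve-∀
    thrice : ∀ y → suc (suc y) + suc (suc y) + suc (suc y) ≡ 6 + (y + y + y)
    thrice = solve-∀

large-from-excess : ∀ x → 1 ≤ x ∸ 1 → 2 ≤ x
large-from-excess (suc (suc x)) _ = s≤s (s≤s z≤n)

large-from-positive : ∀ x → 1 ≤ x → x ≢ 1 → 2 ≤ x
large-from-positive (suc zero)    _ x≢1 = ⊥-elim (x≢1 refl)
large-from-positive (suc (suc x)) _ _   = s≤s (s≤s z≤n)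

empty-from-small : ∀ x → x ≢ 1 → ¬ 2 ≤ x → x ≤ x ∸ 1
empty-from-small zero          _   _      = z≤n
empty-from-small (suc zero)    x≢1 _      = ⊥-elim (x≢1 refl)
empty-from-small (suc (suc x)) _   small  = ⊥-elim (small (s≤s (s≤s z≤n)))

singleton-free-bound : ∀ {k} (π : Vector ℕ k) → (∀ j → π j ≢ 1) → sum π ≤ deficiency π + deficiency π
singleton-free-bound π free =
  subst (sum π ≤_) (∑-distrib-+ (excess π) (excess π)) (sum-mono (λ j → part≤2excess (π j) (free j)))

large-part : ∀ {k} (π : Vector ℕ k) → 1 ≤ deficiency π → Σ[ j ∈ Fin k ] 2 ≤ π j
large-part π positive with positive-term (excess π) positive
... | j , 1≤excess = j , large-from-excess (π j) 1≤excess

singleton-part : ∀ {k} (π : Vector ℕ k) → deficiency π ≡ 0 → 1 ≤ sum π → Σ[ j ∈ Fin k ] π j ≡ 1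
singleton-part π flat positive with positive-term π positive
... | j , 1≤πj = j , ≤-antisym (m∸n≡0⇒m≤n (n≤0⇒n≡0 excess≤0)) 1≤πj
  where
    excess≤0 : π j ∸ 1 ≤ 0
    excess≤0 = subst (π j ∸ 1 ≤_) flat (term≤sum (excess π) j)

size-two-or-bound : ∀ {k} (π : Vector ℕ k) → (∀ j → π j ≢ 1) →
  (Σ[ j ∈ Fin k ] π j ≡ 2) ⊎ (sum π + sum π ≤ deficiency π + deficiency π + deficiency π)
size-two-or-bound π free with any? (λ j → π j ℕ.≟ 2)
... | yes two = inj₁ two
... | no none = inj₂ (subst₂ _≤_ (∑-distrib-+ π π)
        (trans (∑-distrib-+ _ (excess π)) (cong (_+ deficiency π) (∑-distrib-+ (excess π) (excess π))))
        (sum-mono (λ j → 2part≤3excess (π j) (free j) (λ πj≡2 → none (j , πj≡2)))))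

two-large-or-bound : ∀ {k} (π : Vector ℕ k) → (∀ j → π j ≢ 1) → 1 ≤ sum π →
  (Σ[ j ∈ Fin k ] Σ[ j′ ∈ Fin k ] j ≢ j′ × 2 ≤ π j × 2 ≤ π j′) ⊎ (sum π ≤ deficiency π + 1)
two-large-or-bound π free positive
  with positive-term π positive
... | j₀ , 1≤πj₀ with any? (λ j → ¬? (j ≟ j₀) ×-dec (2 ℕ.≤? π j))
...   | yes (j , j≢j₀ , large) =
          inj₁ (j₀ , j , (λ j₀≡j → j≢j₀ (sym j₀≡j)) , large-from-positive (π j₀) 1≤πj₀ (free j₀) , large)
...   | no none = inj₂ (sum-≤-except-one π (excess π) j₀
          (λ j j≢j₀ → empty-from-small (π j) (free j) (λ large → none (j , j≢j₀ , large)))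
          (part≤excess+1 (π j₀)))

two-singletons-or-bound : ∀ {k} (π : Vector ℕ k) →
  (Σ[ e ∈ Fin k ] Σ[ e′ ∈ Fin k ] e ≢ e′ × π e ≡ 1 × π e′ ≡ 1) ⊎
  (sum π ≤ deficiency π + deficiency π + 1)
two-singletons-or-bound π with any? (λ j → π j ℕ.≟ 1)
... | no none = inj₂ (≤-trans (singleton-free-bound π (λ j πj≡1 → none (j , πj≡1)))
                              (m≤m+n _ 1))
... | yes (e , πe≡1) with any? (λ j → ¬? (j ≟ e) ×-dec (π j ℕ.≟ 1))
...   | yes (e′ , e′≢e , πe′≡1) = inj₁ (e , e′ , (λ e≡e′ → e′≢e (sym e≡e′)) , πe≡1 , πe′≡1)
...   | no none = inj₂ (subst (sum π ≤_) (cong (_+ 1) (∑-distrib-+ (excess π) (excess π)))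
          (sum-≤-except-one π (λ j → (π j ∸ 1) + (π j ∸ 1)) e
            (λ j j≢e → part≤2excess (π j) (λ πj≡1 → none (j , j≢e , πj≡1)))
            (part≤2excess+1 (π e))))

indicator : ∀ {A : Set} → Dec A → ℕ
indicator (yes _) = 1
indicator (no _)  = 0

count : ∀ {m k} → (Fin m → Fin k) → Fin k → ℕ
count f j = sum (λ x → indicator (f x ≟ j))

count-positive : ∀ {m k} (f : Fin m → Fin k) y {j} → f y ≡ j → 1 ≤ count f j
count-positive f y {j} fy≡j = ≤-trans (hit (f y ≟ j)) (term≤sum (λ x → indicator (f x ≟ j)) y)
  where
    hit : (d : Dec (f y ≡ j)) → 1 ≤ indicator d
    hit (yes _)    = s≤s z≤n
    hit (no fy≢j) = ⊥-elim (fy≢j fy≡j)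

count-add-point : ∀ {m k} (f : Fin m → Fin k) (π : Vector ℕ k) v → 1 ≤ π v →
  (∀ j → count f j ≡ decrement π v j) → ∀ j → count (v ∷ f) j ≡ π j
count-add-point f π v nonempty sizes j = new-block (v ≟ j)
  where
    new-block : (d : Dec (v ≡ j)) → indicator d + count f j ≡ π j
    new-block (yes refl) = begin
      suc (count f v)          ≡⟨ cong suc (sizes v) ⟩
      suc (decrement π v v)    ≡⟨ cong suc (updateAt-updates v π) ⟩
      1 + (π v ∸ 1)            ≡⟨ m+[n∸m]≡n nonempty ⟩
      π v                      ∎
      where open ≡-Reasoning
    new-block (no v≢j) = trans (sizes j) (updateAt-minimal j v π (λ j≡v → v≢j (sym j≡v)))

AtMostTwo : ∀ {l} → (Fin l → Set) → Set
AtMostTwo {l} P = (a b c : Fin l) → a ≢ b → a ≢ c → b ≢ c → P a → P b → P c → ⊥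

at-most-two : ∀ {l} {P : Fin l → Set} (p q : Fin l) → (∀ h → P h → h ≡ p ⊎ h ≡ q) → AtMostTwo P
at-most-two p q within a b c a≢b a≢c b≢c Pa Pb Pc
  with within a Pa | within b Pb | within c Pc
... | inj₁ refl | inj₁ refl | _         = a≢b refl
... | inj₂ refl | inj₂ refl | _         = a≢b refl
... | inj₁ refl | _         | inj₁ refl = a≢c refl
... | inj₂ refl | _         | inj₂ refl = a≢c refl
... | _         | inj₁ refl | inj₁ refl = b≢c refl
... | _         | inj₂ refl | inj₂ refl = b≢c refl

ThreeWiseDiscrete : ∀ {l m} {K : Fin l → ℕ} → ((h : Fin l) → Fin m → Fin (K h)) → Set
ThreeWiseDiscrete {l} f = (a b c : Fin l) → a ≢ b → a ≢ c → b ≢ c → MeetIsDiscrete (f a) (f b) (f c)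

-- A choice of blocks v is separated from f when every point lies in the
-- chosen block v h for at most two labellings h; this is exactly what is
-- needed to add a new point to the blocks v.
Separated : ∀ {l m} {K : Fin l → ℕ} → ((h : Fin l) → Fin m → Fin (K h)) → ((h : Fin l) → Fin (K h)) → Set
Separated {m = m} f v = (y : Fin m) → AtMostTwo (λ h → f h y ≡ v h)

three-wise-add-point : ∀ {l m} {K : Fin l → ℕ} (f : (h : Fin l) → Fin m → Fin (K h)) v →
  ThreeWiseDiscrete f → Separated f v → ThreeWiseDiscrete (λ h → v h ∷ f h)
three-wise-add-point f v discrete separated a b c a≢b a≢c b≢c = meet
  where
    meet : MeetIsDiscrete (v a ∷ f a) (v b ∷ f b) (v c ∷ f c)
    meet zero    zero    _  _  _  = refl
    meet zero    (suc y) ea eb ec = ⊥-elim (separated y a b c a≢b a≢c b≢c (sym ea) (sym eb) (sym ec))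
    meet (suc x) zero    ea eb ec = ⊥-elim (separated x a b c a≢b a≢c b≢c ea eb ec)
    meet (suc x) (suc y) ea eb ec = cong suc (discrete a b c a≢b a≢c b≢c x y ea eb ec)

record Realisation {l} (m : ℕ) (K : Fin l → ℕ) (π : (h : Fin l) → Vector ℕ (K h)) : Set where
  field
    label    : (h : Fin l) → Fin m → Fin (K h)
    sizes    : ∀ h j → count (label h) j ≡ π h j
    discrete : ThreeWiseDiscrete label
open Realisation

separated-by-sizes : ∀ {l m} {K : Fin l → ℕ} {ρ} (R : Realisation m K ρ) v (p q : Fin l) →
  (∀ h → 1 ≤ ρ h (v h) → h ≡ p ⊎ h ≡ q) → Separated (label R) v
separated-by-sizes R v p q only-pq y = at-most-two p q (λ h in-block → only-pq h
  (subst (1 ≤_) (sizes R h (v h)) (count-positive (label R h) y in-block)))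

add-point : ∀ {l m} {K : Fin l → ℕ} {π : (h : Fin l) → Vector ℕ (K h)} v → (∀ h → 1 ≤ π h (v h)) →
  (R : Realisation m K (λ h → decrement (π h) (v h))) → Separated (label R) v → Realisation (suc m) K π
add-point {π = π} v nonempty R separated = record
  { label    = λ h → v h ∷ label R h
  ; sizes    = λ h → count-add-point (label R h) (π h) (v h) (nonempty h) (sizes R h)
  ; discrete = three-wise-add-point (label R) v (discrete R) separated
  }

-- Adding two points at once, into blocks u₁ h and u₂ h: the old points
-- must avoid these blocks outside p and q, and the two new points may share
-- a block only in the single labelling r.
add-two-points : ∀ {l m} {K : Fin l → ℕ} {π : (h : Fin l) → Vector ℕ (K h)} u₁ u₂ →
  (∀ h → 1 ≤ π h (u₁ h)) → (∀ h → 1 ≤ decrement (π h) (u₁ h) (u₂ h)) →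
  (R : Realisation m K (λ h → decrement (decrement (π h) (u₁ h)) (u₂ h))) → (p q r : Fin l) →
  (∀ h → 1 ≤ decrement (decrement (π h) (u₁ h)) (u₂ h) (u₁ h) → h ≡ p ⊎ h ≡ q) →
  (∀ h → 1 ≤ decrement (decrement (π h) (u₁ h)) (u₂ h) (u₂ h) → h ≡ p ⊎ h ≡ q) →
  (∀ h → u₂ h ≡ u₁ h → h ≡ r) → Realisation (suc (suc m)) K π
add-two-points {m = m} {K} {π} u₁ u₂ nonempty₁ nonempty₂ R p q r only-pq₁ only-pq₂ only-r =
  add-point u₁ nonempty₁ R′ separated₁
  where
    R′ : Realisation (suc m) K (λ h → decrement (π h) (u₁ h))
    R′ = add-point u₂ nonempty₂ R (separated-by-sizes R u₂ p q only-pq₂)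
    separated₁ : Separated (label R′) u₁
    separated₁ zero    = at-most-two r r (λ h shared → inj₁ (only-r h shared))
    separated₁ (suc y) = separated-by-sizes R u₁ p q only-pq₁ y

argmax : ∀ {n} (w : Vector ℕ (suc n)) → Σ[ i ∈ Fin (suc n) ] (∀ j → w j ≤ w i)
argmax {zero}  w = zero , λ { zero → ≤-refl }
argmax {suc n} w with argmax (w ∘ suc)
... | i , max with w zero ≤? w (suc i)
...   | yes w₀≤ = suc i , λ { zero → w₀≤ ; (suc j) → max j }
...   | no w₀≰  = zero  , λ { zero → ≤-refl ; (suc j) → ≤-trans (max j) (<⇒≤ (≰⇒> w₀≰)) }

record TopTwo {n} (w : Vector ℕ (suc n)) : Set where
  field
    first second : Fin (suc n)
    first-max    : ∀ h → w h ≤ w first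
    second-max   : ∀ h → h ≢ first → w h ≤ w second
    distinct     : second ≢ first ⊎ (∀ h → h ≢ first → w h ≡ 0)

top-two : ∀ {n} (w : Vector ℕ (suc n)) → TopTwo w
top-two w with argmax w
... | first , first-max with argmax (without w first)
...   | second , rest-max with second ≟ first
...     | yes refl = record
          { first = first ; second = first ; first-max = first-max
          ; second-max = λ h _ → first-max h
          ; distinct = inj₂ (λ h h≢first → n≤0⇒n≡0 (subst₂ _≤_
              (updateAt-minimal h first w h≢first) (updateAt-updates first w) (rest-max h))) }
...     | no second≢first = record
          { first = first ; second = second ; first-max = first-max
          ; second-max = λ h h≢first → subst₂ _≤_
              (updateAt-minimal h first w h≢first) (updateAt-minimal second first w second≢first) (rest-max h)
          ; distinct = inj₁ second≢first }

halve-bound : ∀ c n x → c + c + x ≤ n + n → x ≤ (n ∸ c) + (n ∸ c)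
halve-bound zero    n       x le = le
halve-bound (suc c) zero    x ()
halve-bound (suc c) (suc n) x le = halve-bound c n x (≤-pred (≤-pred (subst₂ _≤_ (shift c x) (+-suc (suc n) n) le)))
  where
    shift : ∀ c x → suc c + suc c + x ≡ suc (suc (c + c + x))
    shift = solve-∀

-- The numerical contradictions behind the two-point step, where the common
-- total is n + 1 and the total deficiency at most n + n.
module TwoPointArithmetic {n : ℕ} where
  three-large : ∀ {x} → suc n + suc n ≤ x + x + x → x + x + x ≤ n + n → ⊥
  three-large le₁ le₂ = 1+n≰n (begin
    suc (n + n)     ≤⟨ s≤s (+-monoʳ-≤ n (n≤1+n n)) ⟩
    suc n + suc n   ≤⟨ le₁ ⟩
    _               ≤⟨ le₂ ⟩
    n + n           ∎)
    where open ≤-Reasoning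

  one-huge-two-large : ∀ {x y} → suc n ≤ y + 1 → suc n ≤ x + x → y + x + x ≤ n + n → ⊥
  one-huge-two-large {x} {y} le₁ le₂ le₃ = 1+n≰n (begin
    suc (suc (n + n))   ≡⟨ cong suc (+-suc n n) ⟨
    suc n + suc n       ≤⟨ +-mono-≤ le₁ le₂ ⟩
    y + 1 + (x + x)     ≡⟨ regroup y x ⟩
    suc (y + x + x)     ≤⟨ s≤s le₃ ⟩
    suc (n + n)         ∎)
    where
      open ≤-Reasoning
      regroup : ∀ y x → y + 1 + (x + x) ≡ suc (y + x + x)
      regroup = solve-∀

  three-large-one-half : ∀ {x y} → suc n ≤ y + y + 1 → suc n ≤ x + x → x + x + x + y ≤ n + n → ⊥
  three-large-one-half {x} {y} le₁ le₂ le₃ = 1+n≰n (begin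
    suc (suc (n + n + (n + n)))              ≤⟨ m≤n+m _ 2 ⟩
    suc (suc (suc (suc (n + n + (n + n)))))  ≡⟨ expand n ⟩
    suc n + suc n + (suc n + suc n)          ≤⟨ +-mono-≤ (+-mono-≤ le₂ le₂) (+-mono-≤ le₂ le₁) ⟩
    x + x + (x + x) + (x + x + (y + y + 1))  ≡⟨ regroup x y ⟩
    suc (x + x + x + y + (x + x + x + y))    ≤⟨ s≤s (+-mono-≤ le₃ le₃) ⟩
    suc (n + n + (n + n))                    ∎)
    where
      open ≤-Reasoning
      expand : ∀ n → suc (suc (suc (suc (n + n + (n + n))))) ≡ suc n + suc n + (suc n + suc n)
      expand = solve-∀
      regroup : ∀ x y → x + x + (x + x) + (x + x + (y + y + 1)) ≡ suc (x + x + x + y + (x + x + x + y))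
      regroup = solve-∀

totalDeficiency : ∀ {l} {K : Fin l → ℕ} → ((h : Fin l) → Vector ℕ (K h)) → ℕ
totalDeficiency π = sum (λ h → deficiency (π h))

record Admissible {l} (m : ℕ) (K : Fin l → ℕ) (π : (h : Fin l) → Vector ℕ (K h)) : Set where
  field
    totals : ∀ h → sum (π h) ≡ m
    bound  : totalDeficiency π ≤ (m ∸ 1) + (m ∸ 1)

Realisable : ℕ → Set
Realisable m = ∀ {l} (K : Fin l → ℕ) π → Admissible m K π → Realisation m K π

realisable-zero : Realisable 0
realisable-zero K π admissible = record
  { label    = λ h ()
  ; sizes    = λ h j → sym (n≤0⇒n≡0 (subst (π h j ≤_) (Admissible.totals admissible h) (term≤sum (π h) j)))
  ; discrete = λ _ _ _ _ _ _ ()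
  }

realisable-no-partitions : ∀ m (K : Fin 0 → ℕ) π → Realisation m K π
realisable-no-partitions m K π = record { label = λ () ; sizes = λ () ; discrete = λ () }

module Step {m′ l′ : ℕ} (IH : ∀ {n} → n < suc m′ → Realisable n)
            (K : Fin (suc l′) → ℕ) (π : (h : Fin (suc l′)) → Vector ℕ (K h))
            (admissible : Admissible (suc m′) K π) where
  open Admissible admissible

  m : ℕ
  m = suc m′

  d : Fin (suc l′) → ℕ
  d h = deficiency (π h)

  HasSingleton : Fin (suc l′) → Set
  HasSingleton h = Σ[ j ∈ Fin (K h) ] π h j ≡ 1

  singleton? : ∀ h → Dec (HasSingleton h)
  singleton? h = any? (λ j → π h j ℕ.≟ 1)

  -- Partitions without singleton blocks are heavier than all others.
  weight : Fin (suc l′) → ℕ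
  weight h with singleton? h
  ... | yes _ = d h
  ... | no  _ = m + d h

  total-positive : ∀ h → 1 ≤ sum (π h)
  total-positive h = subst (1 ≤_) (sym (totals h)) (s≤s z≤n)

  no-deficiency : ∀ h → ¬ 1 ≤ d h → d h ≡ 0
  no-deficiency h flat = n<1⇒n≡0 (≰⇒> flat)

  d<m : ∀ h → d h < m
  d<m h = subst (suc (d h) ≤_) (totals h) (deficiency<sum (π h) (total-positive h))

  d≤weight : ∀ h → d h ≤ weight h
  d≤weight h with singleton? h
  ... | yes _ = ≤-refl
  ... | no  _ = m≤n+m (d h) m

  weight-free : ∀ h → ¬ HasSingleton h → weight h ≡ m + d h
  weight-free h free with singleton? h
  ... | yes one = ⊥-elim (free one)
  ... | no  _   = refl

  weight-flat : ∀ h → ¬ 1 ≤ d h → weight h ≡ 0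
  weight-flat h flat with singleton? h
  ... | yes _    = no-deficiency h flat
  ... | no  free = ⊥-elim (free (singleton-part (π h) (no-deficiency h flat) (total-positive h)))

  heavy-is-free : ∀ h {x} → m + x ≤ weight h → ¬ HasSingleton h × x ≤ d h
  heavy-is-free h {x} heavy with singleton? h
  ... | yes _ = ⊥-elim (<⇒≱ (d<m h) (≤-trans (m≤m+n m x) heavy))
  ... | no free = free , +-cancelˡ-≤ m x (d h) heavy

  weightless : ∀ h → weight h ≤ 0 → d h ≡ 0
  weightless h le = n≤0⇒n≡0 (≤-trans (d≤weight h) le)

  top : TopTwo weight
  top = top-two weight
  open TopTwo top renaming (first to h₁; second to h₂)

  two-deficient-or-one : (h₂ ≢ h₁ × 1 ≤ d h₁ × 1 ≤ d h₂) ⊎ (∀ h → h ≢ h₁ → d h ≡ 0)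
  two-deficient-or-one with 1 ≤? d h₁ | 1 ≤? d h₂ | distinct
  ... | no flat₁ | _       | _ = inj₂ (λ h _ → weightless h (subst (weight h ≤_) (weight-flat h₁ flat₁) (first-max h)))
  ... | yes _    | no flat₂ | _ = inj₂ (λ h h≢h₁ → weightless h (subst (weight h ≤_) (weight-flat h₂ flat₂) (second-max h h≢h₁)))
  ... | yes _    | yes _   | inj₂ rest-zero = inj₂ (λ h h≢h₁ → weightless h (≤-reflexive (rest-zero h h≢h₁)))
  ... | yes pos₁ | yes pos₂ | inj₁ h₂≢h₁ = inj₁ (h₂≢h₁ , pos₁ , pos₂)

  IsTop : Fin (suc l′) → Set
  IsTop h = h ≡ h₁ ⊎ h ≡ h₂

  positive-only-top : ∀ h {x} → (h ≢ h₁ → h ≢ h₂ → x ≡ 0) → 1 ≤ x → IsTop h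
  positive-only-top h vanishes positive with h ≟ h₁ | h ≟ h₂
  ... | yes h≡h₁ | _        = inj₁ h≡h₁
  ... | no _     | yes h≡h₂ = inj₂ h≡h₂
  ... | no h≢h₁  | no h≢h₂  = ⊥-elim (<⇒≱ positive (≤-reflexive (vanishes h≢h₁ h≢h₂)))

  -- Case 1: every partition other than h₁, h₂ has a singleton block.  Remove
  -- one point, taken from a singleton block in those partitions and from a
  -- block of size ≥ 2 (if there is one) in h₁ and h₂.
  module OnePoint (singletons : ∀ h → h ≢ h₁ → h ≢ h₂ → HasSingleton h) where

    record BlockChoice (h : Fin (suc l′)) : Set where
      field
        block          : Fin (K h)
        nonempty       : 1 ≤ π h block
        large-only-top : 2 ≤ π h block → IsTop h
        top-shrinks    : IsTop h → 1 ≤ d h → 2 ≤ π h block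

    choose-top : ∀ h → IsTop h → BlockChoice h
    choose-top h is-top with 1 ≤? d h
    ... | yes deficient with large-part (π h) deficient
    ...   | j , large = record { block = j ; nonempty = ≤-trans (s≤s z≤n) large
                               ; large-only-top = λ _ → is-top ; top-shrinks = λ _ _ → large }
    choose-top h is-top | no flat with singleton-part (π h) (no-deficiency h flat) (total-positive h)
    ...   | j , single = record { block = j ; nonempty = ≤-reflexive (sym single)
                                ; large-only-top = λ large → ⊥-elim (<⇒≱ large (≤-reflexive single))
                                ; top-shrinks = λ _ deficient → ⊥-elim (flat deficient) }

    choose : ∀ h → BlockChoice h
    choose h with h ≟ h₁ | h ≟ h₂
    ... | yes h≡h₁ | _        = choose-top h (inj₁ h≡h₁)
    ... | no _     | yes h≡h₂ = choose-top h (inj₂ h≡h₂)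
    ... | no h≢h₁  | no h≢h₂  with singletons h h≢h₁ h≢h₂
    ...   | j , single = record { block = j ; nonempty = ≤-reflexive (sym single)
                                ; large-only-top = λ large → ⊥-elim (<⇒≱ large (≤-reflexive single))
                                ; top-shrinks = λ { (inj₁ h≡h₁) → ⊥-elim (h≢h₁ h≡h₁)
                                                  ; (inj₂ h≡h₂) → ⊥-elim (h≢h₂ h≡h₂) } }
    open BlockChoice

    v : (h : Fin (suc l′)) → Fin (K h)
    v h = block (choose h)

    π′ : (h : Fin (suc l′)) → Vector ℕ (K h)
    π′ h = decrement (π h) (v h)

    d′ : Fin (suc l′) → ℕ
    d′ h = deficiency (π′ h)

    totals′ : ∀ h → sum (π′ h) ≡ m′
    totals′ h = suc-injective (trans (sum-decrement (π h) (v h) (nonempty (choose h))) (totals h))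

    shrinks : ∀ h → IsTop h → 1 ≤ d h → 1 + d′ h ≤ d h
    shrinks h is-top deficient =
      ≤-reflexive (deficiency-decrement (π h) (v h) (top-shrinks (choose h) is-top deficient))

    -- If only h₁ is deficient, its deficiency d h₁ < m drops below m′.
    single-deficient-bound : (∀ h → h ≢ h₁ → d h ≡ 0) → totalDeficiency π′ ≤ (m′ ∸ 1) + (m′ ∸ 1)
    single-deficient-bound others-flat = begin
      totalDeficiency π′  ≡⟨ sum-single d′ h₁ (λ h h≢h₁ → n≤0⇒n≡0
                               (subst (d′ h ≤_) (others-flat h h≢h₁) (deficiency-decrement-≤ (π h) (v h)))) ⟩
      d′ h₁               ≤⟨ d′₁-bound ⟩
      m′ ∸ 1              ≤⟨ m≤m+n _ _ ⟩
      (m′ ∸ 1) + (m′ ∸ 1) ∎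
      where
        open ≤-Reasoning
        d′₁-bound : d′ h₁ ≤ m′ ∸ 1
        d′₁-bound with 1 ≤? d h₁
        ... | yes deficient = ∸-monoˡ-≤ 1 (≤-trans (shrinks h₁ (inj₁ refl) deficient) (≤-pred (d<m h₁)))
        ... | no flat = ≤-trans (deficiency-decrement-≤ (π h₁) (v h₁)) (≤-trans (≤-reflexive (no-deficiency h₁ flat)) z≤n)

    bound′ : totalDeficiency π′ ≤ (m′ ∸ 1) + (m′ ∸ 1)
    bound′ with two-deficient-or-one
    ... | inj₂ others-flat = single-deficient-bound others-flat
    ... | inj₁ (h₂≢h₁ , deficient₁ , deficient₂) = halve-bound 1 m′ _ (≤-trans
          (sum-gap 1 (λ h₁≡h₂ → h₂≢h₁ (sym h₁≡h₂)) (λ h → deficiency-decrement-≤ (π h) (v h))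
                     (shrinks h₁ (inj₁ refl) deficient₁) (shrinks h₂ (inj₂ refl) deficient₂))
          bound)

    result : Realisation m K π
    result = add-point v (λ h → nonempty (choose h)) R′ (separated-by-sizes R′ v h₁ h₂ only-top)
      where
        R′ : Realisation m′ K π′
        R′ = IH ≤-refl K π′ record { totals = totals′ ; bound = bound′ }
        only-top : ∀ h → 1 ≤ π′ h (v h) → IsTop h
        only-top h positive = large-only-top (choose h)
          (large-from-excess (π h (v h)) (subst (1 ≤_) (updateAt-updates (v h) (π h)) positive))

  -- Case 2: some partition h₃ other than h₁, h₂ has no singleton block.  Then
  -- h₁, h₂, h₃ are singleton-free and d h₃ ≤ d h₁, d h₂, and counting forces
  -- h₃ to have a block of size 2, h₁ and h₂ to have two blocks of size ≥ 2
  -- and every other partition to have two singleton blocks.  Remove two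
  -- points: the block of size 2 of h₃, one point from each of two large
  -- blocks of h₁ and of h₂, and two singleton blocks elsewhere.
  module TwoPoints (h₃ : Fin (suc l′)) (h₃≢h₁ : h₃ ≢ h₁) (h₃≢h₂ : h₃ ≢ h₂) (free₃ : ¬ HasSingleton h₃) where
    heavy₂ : m + d h₃ ≤ weight h₂
    heavy₂ = subst (_≤ weight h₂) (weight-free h₃ free₃) (second-max h₃ h₃≢h₁)

    h₁≢h₂ : h₁ ≢ h₂
    h₁≢h₂ h₁≡h₂ with distinct
    ... | inj₁ h₂≢h₁    = h₂≢h₁ (sym h₁≡h₂)
    ... | inj₂ rest-zero with trans (sym (weight-free h₃ free₃)) (rest-zero h₃ h₃≢h₁)
    ...   | ()

    d₃≤d₂ : d h₃ ≤ d h₂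
    d₃≤d₂ = proj₂ (heavy-is-free h₂ heavy₂)

    d₃≤d₁ : d h₃ ≤ d h₁
    d₃≤d₁ = proj₂ (heavy-is-free h₁ (≤-trans heavy₂ (first-max h₂)))

    free-top : ∀ h → IsTop h → ¬ HasSingleton h
    free-top h (inj₁ refl) = proj₁ (heavy-is-free h₁ (≤-trans heavy₂ (first-max h₂)))
    free-top h (inj₂ refl) = proj₁ (heavy-is-free h₂ heavy₂)

    no-singleton : ∀ h → ¬ HasSingleton h → ∀ j → π h j ≢ 1
    no-singleton h free j single = free (j , single)

    m≤2d₃ : m ≤ d h₃ + d h₃
    m≤2d₃ = subst (_≤ d h₃ + d h₃) (totals h₃) (singleton-free-bound (π h₃) (no-singleton h₃ free₃))

    three-weakest : d h₃ + d h₃ + d h₃ ≤ totalDeficiency π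
    three-weakest = ≤-trans (+-monoˡ-≤ (d h₃) (+-mono-≤ d₃≤d₁ d₃≤d₂))
                            (triple≤sum d h₁≢h₂ (h₃≢h₁ ∘ sym) (h₃≢h₂ ∘ sym))

    top-and-weakest : ∀ h → IsTop h → d h + d h₃ + d h₃ ≤ totalDeficiency π
    top-and-weakest h (inj₁ refl) = ≤-trans (+-monoˡ-≤ (d h₃) (+-monoʳ-≤ (d h₁) d₃≤d₂))
                                            (triple≤sum d h₁≢h₂ (h₃≢h₁ ∘ sym) (h₃≢h₂ ∘ sym))
    top-and-weakest h (inj₂ refl) = ≤-trans (+-monoˡ-≤ (d h₃) (+-monoʳ-≤ (d h₂) d₃≤d₁))
                                            (triple≤sum d (h₁≢h₂ ∘ sym) (h₃≢h₂ ∘ sym) (h₃≢h₁ ∘ sym))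

    three-weakest-and : ∀ h → h ≢ h₁ → h ≢ h₂ → h ≢ h₃ → d h₃ + d h₃ + d h₃ + d h ≤ totalDeficiency π
    three-weakest-and h h≢h₁ h≢h₂ h≢h₃ = ≤-trans (+-monoˡ-≤ (d h) (+-monoˡ-≤ (d h₃) (+-mono-≤ d₃≤d₁ d₃≤d₂)))
      (quad≤sum d h₁≢h₂ (h₃≢h₁ ∘ sym) (h≢h₁ ∘ sym) (h₃≢h₂ ∘ sym) (h≢h₂ ∘ sym) (h≢h₃ ∘ sym))

    open TwoPointArithmetic {m′}

    record PairChoice (h : Fin (suc l′)) : Set where
      field
        first second    : Fin (K h)
        first-nonempty  : 1 ≤ π h first
        second-nonempty : 1 ≤ decrement (π h) first second
      remainder : Vector ℕ (K h)
      remainder = decrement (decrement (π h) first) second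
      field
        emptied     : h ≢ h₁ → h ≢ h₂ → remainder first ≡ 0 × remainder second ≡ 0
        apart       : second ≡ first → h ≡ h₃
        top-shrinks : IsTop h → 2 + deficiency remainder ≤ d h

    choose-weakest : PairChoice h₃
    choose-weakest with size-two-or-bound (π h₃) (no-singleton h₃ free₃)
    ... | inj₂ all-large = ⊥-elim (three-large {d h₃}
            (subst (λ x → x + x ≤ d h₃ + d h₃ + d h₃) (totals h₃) all-large) (≤-trans three-weakest bound))
    ... | inj₁ (j , two) = record
      { first = j ; second = j
      ; first-nonempty  = subst (1 ≤_) (sym two) (s≤s z≤n)
      ; second-nonempty = subst (1 ≤_) (sym (trans (updateAt-updates j (π h₃)) (cong (_∸ 1) two))) (s≤s z≤n)
      ; emptied     = λ _ _ → emptied , emptied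
      ; apart       = λ _ → refl
      ; top-shrinks = λ { (inj₁ h₃≡h₁) → ⊥-elim (h₃≢h₁ h₃≡h₁) ; (inj₂ h₃≡h₂) → ⊥-elim (h₃≢h₂ h₃≡h₂) } }
      where
        emptied : decrement (decrement (π h₃) j) j j ≡ 0
        emptied = trans (updateAt-updates j (decrement (π h₃) j))
                        (cong (_∸ 1) (trans (updateAt-updates j (π h₃)) (cong (_∸ 1) two)))

    choose-top : ∀ h → IsTop h → PairChoice h
    choose-top h is-top with two-large-or-bound (π h) (no-singleton h (free-top h is-top)) (total-positive h)
    ... | inj₂ one-block = ⊥-elim (one-huge-two-large {d h₃} {d h}
            (subst (_≤ d h + 1) (totals h) one-block) m≤2d₃ (≤-trans (top-and-weakest h is-top) bound))
    ... | inj₁ (j , j′ , j≢j′ , large , large′) = record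
      { first = j ; second = j′
      ; first-nonempty  = ≤-trans (s≤s z≤n) large
      ; second-nonempty = ≤-trans (s≤s z≤n) large″
      ; emptied     = λ h≢h₁ h≢h₂ → ⊥-elim ([ h≢h₁ , h≢h₂ ]′ is-top)
      ; apart       = λ j′≡j → ⊥-elim (j≢j′ (sym j′≡j))
      ; top-shrinks = λ _ → ≤-reflexive (trans (cong suc (deficiency-decrement (decrement (π h) j) j′ large″))
                                               (deficiency-decrement (π h) j large)) }
      where
        large″ : 2 ≤ decrement (π h) j j′
        large″ = subst (2 ≤_) (sym (updateAt-minimal j′ j (π h) (j≢j′ ∘ sym))) large′

    choose-other : ∀ h → h ≢ h₁ → h ≢ h₂ → h ≢ h₃ → PairChoice h
    choose-other h h≢h₁ h≢h₂ h≢h₃ with two-singletons-or-bound (π h)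
    ... | inj₂ few-singletons = ⊥-elim (three-large-one-half {d h₃} {d h}
            (subst (_≤ d h + d h + 1) (totals h) few-singletons) m≤2d₃ (≤-trans (three-weakest-and h h≢h₁ h≢h₂ h≢h₃) bound))
    ... | inj₁ (e , e′ , e≢e′ , single , single′) = record
      { first = e ; second = e′
      ; first-nonempty  = ≤-reflexive (sym single)
      ; second-nonempty = ≤-reflexive (sym single″)
      ; emptied     = λ _ _ → trans (updateAt-minimal e e′ (decrement (π h) e) e≢e′)
                                    (trans (updateAt-updates e (π h)) (cong (_∸ 1) single))
                            , trans (updateAt-updates e′ (decrement (π h) e)) (cong (_∸ 1) single″)
      ; apart       = λ e′≡e → ⊥-elim (e≢e′ (sym e′≡e))
      ; top-shrinks = λ { (inj₁ h≡h₁) → ⊥-elim (h≢h₁ h≡h₁) ; (inj₂ h≡h₂) → ⊥-elim (h≢h₂ h≡h₂) } }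
      where
        single″ : decrement (π h) e e′ ≡ 1
        single″ = trans (updateAt-minimal e′ e (π h) (e≢e′ ∘ sym)) single′

    choose : ∀ h → PairChoice h
    choose h with h ≟ h₁ | h ≟ h₂ | h ≟ h₃
    ... | yes h≡h₁ | _        | _        = choose-top h (inj₁ h≡h₁)
    ... | no _     | yes h≡h₂ | _        = choose-top h (inj₂ h≡h₂)
    ... | no _     | no _     | yes refl = choose-weakest
    ... | no h≢h₁  | no h≢h₂  | no h≢h₃  = choose-other h h≢h₁ h≢h₂ h≢h₃
    open PairChoice

    u₁ u₂ : (h : Fin (suc l′)) → Fin (K h)
    u₁ h = first (choose h)
    u₂ h = second (choose h)

    π″ : (h : Fin (suc l′)) → Vector ℕ (K h)
    π″ h = remainder (choose h)

    totals″ : ∀ h → suc (sum (π″ h)) ≡ m′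
    totals″ h = suc-injective (begin
      suc (suc (sum (π″ h)))                   ≡⟨ cong suc (sum-decrement (decrement (π h) (u₁ h)) (u₂ h) (second-nonempty (choose h))) ⟩
      suc (sum (decrement (π h) (u₁ h)))       ≡⟨ sum-decrement (π h) (u₁ h) (first-nonempty (choose h)) ⟩
      sum (π h)                                ≡⟨ totals h ⟩
      suc m′                                   ∎)
      where open ≡-Reasoning

    -- Removing two points leaves partitions of m′ - 1 = m - 2; in particular m′ ≥ 1.
    m′-positive : suc (m′ ∸ 1) ≡ m′
    m′-positive = subst (λ n → suc (n ∸ 1) ≡ n) (totals″ h₃) refl

    bound″ : totalDeficiency π″ ≤ (m′ ∸ 1 ∸ 1) + (m′ ∸ 1 ∸ 1)
    bound″ = subst (λ n → totalDeficiency π″ ≤ n + n) (sym (∸-+-assoc m′ 1 1)) (halve-bound 2 m′ _ (≤-trans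
      (sum-gap 2 h₁≢h₂ (λ h → ≤-trans (deficiency-decrement-≤ (decrement (π h) (u₁ h)) (u₂ h))
                                      (deficiency-decrement-≤ (π h) (u₁ h)))
                 (top-shrinks (choose h₁) (inj₁ refl)) (top-shrinks (choose h₂) (inj₂ refl)))
      bound))

    result : Realisation m K π
    result = subst (λ n → Realisation (suc n) K π) m′-positive
      (add-two-points u₁ u₂ (λ h → first-nonempty (choose h)) (λ h → second-nonempty (choose h)) R″ h₁ h₂ h₃
        (λ h → positive-only-top h (λ h≢h₁ h≢h₂ → proj₁ (emptied (choose h) h≢h₁ h≢h₂)))
        (λ h → positive-only-top h (λ h≢h₁ h≢h₂ → proj₂ (emptied (choose h) h≢h₁ h≢h₂)))
        (λ h → apart (choose h)))
      where
        R″ : Realisation (m′ ∸ 1) K π″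
        R″ = IH (s≤s (m∸n≤m m′ 1)) K π″
                record { totals = λ h → cong (_∸ 1) (totals″ h) ; bound = bound″ }

  result : Realisation m K π
  result with any? (λ h → ¬? (h ≟ h₁) ×-dec ¬? (h ≟ h₂) ×-dec ¬? (singleton? h))
  ... | yes (h₃ , h₃≢h₁ , h₃≢h₂ , free₃) = TwoPoints.result h₃ h₃≢h₁ h₃≢h₂ free₃
  ... | no none = OnePoint.result (λ h h≢h₁ h≢h₂ →
          decidable-stable (singleton? h) (λ free → none (h , h≢h₁ , h≢h₂ , free)))

realisable : ∀ m → Realisable m
realisable = <-rec Realisable step
  where
    step : ∀ m → (∀ {n} → n < m → Realisable n) → Realisable m
    step zero     _  = realisable-zero
    step (suc m′) IH {zero}   K π _          = realisable-no-partitions (suc m′) K π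
    step (suc m′) IH {suc l′} K π admissible = Step.result IH K π admissible

length-filter-tabulate : ∀ {A : Set} {P : A → Set} (P? : Decidable P) n (g : Fin n → A) →
  List.length (List.filter P? (List.tabulate g)) ≡ sum (λ i → indicator (P? (g i)))
length-filter-tabulate P? zero    g = refl
length-filter-tabulate P? (suc n) g with P? (g zero)
... | yes _ = cong suc (length-filter-tabulate P? n (g ∘ suc))
... | no  _ = length-filter-tabulate P? n (λ i → g (suc i))

has-shape : ∀ {m k} (f : Fin m → Fin k) (π : Vec ℕ k) → (∀ j → count f j ≡ lookup π j) → HasShape f π
has-shape {m} f π counts = ↭-reflexive (cong toList (trans
  (tabulate-cong (λ j → trans (length-filter-tabulate (λ x → f x ≟ j) m (λ x → x)) (counts j)))
  (tabulate∘lookup π)))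

vec-sum : ∀ {n} (v : Vec ℕ n) → Vec.sum v ≡ sum (lookup v)
vec-sum Vec.[]      = refl
vec-sum (x Vec.∷ v) = cong (λ s → x + s) (vec-sum v)

open import Data.Integer using (ℤ; +_; _-_) renaming (_≤_ to _≤ℤ_; _*_ to _*ℤ_; _+_ to _+ℤ_)
import Data.Integer.Properties as ℤ
open import Data.Integer.Tactic.RingSolver using () renaming (solve-∀ to solve-∀ℤ)

hypothesis-in-ℕ : ∀ m l s → + m *ℤ (+ l - + 2) ≤ℤ + s - + 2 → m * l + 2 ≤ s + m * 2
hypothesis-in-ℕ m l s hyp = ℤ.drop‿+≤+ (subst₂ _≤ℤ_ (left m l) (right m s) (ℤ.+-monoˡ-≤ (+ m *ℤ + 2 +ℤ + 2) hyp))
  where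
    left : ∀ m l → + m *ℤ (+ l - + 2) +ℤ (+ m *ℤ + 2 +ℤ + 2) ≡ + (m * l + 2)
    left m l = trans (normalise (+ m) (+ l)) (trans (cong (λ z → z +ℤ + 2) (sym (ℤ.pos-* m l))) (sym (ℤ.pos-+ (m * l) 2)))
      where
        normalise : ∀ x y → x *ℤ (y - + 2) +ℤ (x *ℤ + 2 +ℤ + 2) ≡ x *ℤ y +ℤ + 2
        normalise = solve-∀ℤ
    right : ∀ m s → + s - + 2 +ℤ (+ m *ℤ + 2 +ℤ + 2) ≡ + (s + m * 2)
    right m s = trans (normalise (+ s) (+ m)) (trans (cong (λ z → + s +ℤ z) (sym (ℤ.pos-* m 2))) (sym (ℤ.pos-+ s (m * 2))))
      where
        normalise : ∀ x y → x - + 2 +ℤ (y *ℤ + 2 +ℤ + 2) ≡ x +ℤ y *ℤ + 2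
        normalise = solve-∀ℤ

deficiencies+parts : ∀ {l} m (ks : Vec ℕ l) (π : (h : Fin l) → Vec ℕ (lookup ks h)) →
  ((h : Fin l) → IsNumPartition m (lookup ks h) (π h)) →
  totalDeficiency (λ h → lookup (π h)) + Vec.sum ks ≡ l * m
deficiencies+parts {l} m ks π partitions = begin
  totalDeficiency π′ + Vec.sum ks               ≡⟨ cong (λ x → totalDeficiency π′ + x) (vec-sum ks) ⟩
  totalDeficiency π′ + sum (lookup ks)          ≡⟨ ∑-distrib-+ (λ h → deficiency (π′ h)) (lookup ks) ⟨
  sum (λ h → deficiency (π′ h) + lookup ks h)   ≡⟨ sum-cong-≗ partition-of-m ⟩
  sum {l} (λ _ → m)                             ≡⟨ sum-const l m ⟩
  l * m                                         ∎
  where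
    open ≡-Reasoning
    π′ : (h : Fin l) → Vector ℕ (lookup ks h)
    π′ h = lookup (π h)
    partition-of-m : ∀ h → deficiency (π′ h) + lookup ks h ≡ m
    partition-of-m h = trans (deficiency+parts (π′ h) (lookup⁺ (proj₁ (partitions h))))
                             (trans (sym (vec-sum (π h))) (proj₂ (partitions h)))

deficiency-bound : ∀ m l s D → D + s ≡ l * m → m * l + 2 ≤ s + m * 2 → D ≤ (m ∸ 1) + (m ∸ 1)
deficiency-bound m l s D total hyp = halve-bound 1 m D (+-cancelˡ-≤ s _ _ (subst₂ _≤_ left right hyp))
  where
    left : m * l + 2 ≡ s + (2 + D)
    left = trans (cong (_+ 2) (trans (*-comm m l) (sym total))) (regroup D s)
      where
        regroup : ∀ D s → D + s + 2 ≡ s + (2 + D)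
        regroup = solve-∀
    right : s + m * 2 ≡ s + (m + m)
    right = cong (λ x → s + x) (double m)
      where
        double : ∀ m → m * 2 ≡ m + m
        double = solve-∀

lemma2p6 : (l m : ℕ) (ks : Vec ℕ l) → 1 ≤ l → 1 ≤ m → ((h : Fin l) → 1 ≤ lookup ks h)
    → (+ m *ℤ (+ l - + 2)) ≤ℤ (+ Vec.sum ks - + 2)
    → (π : (h : Fin l) → Vec ℕ (lookup ks h))
    → ((h : Fin l) → IsNumPartition m (lookup ks h) (π h))
    → Σ ((h : Fin l) → Fin m → Fin (lookup ks h)) (λ Π →
        ((h : Fin l) → HasShape (Π h) (π h))
        × ((a b c : Fin l) → a ≢ b → a ≢ c → b ≢ c → MeetIsDiscrete (Π a) (Π b) (Π c)))
lemma2p6 l m ks _ _ _ hypothesis π partitions =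
  label R , (λ h → has-shape (label R h) (π h) (sizes R h)) , discrete R
  where
    admissible : Admissible m (lookup ks) (λ h → lookup (π h))
    admissible = record
      { totals = λ h → trans (sym (vec-sum (π h))) (proj₂ (partitions h))
      ; bound  = deficiency-bound m l (Vec.sum ks) _ (deficiencies+parts m ks π partitions)
                                  (hypothesis-in-ℕ m l (Vec.sum ks) hypothesis) }
    R : Realisation m (lookup ks) (λ h → lookup (π h))
    R = realisable m (lookup ks) (λ h → lookup (π h)) admissible
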